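{- Let $k$ be a positive integer with $k\equiv 3 \pmod 5$. Then $va_3^{\equiv}(K_{4k,4k,4k})\leq \frac{12k+4}{5}$.
   Context: All graphs are finite and simple. A $t$-coloring of a graph $G$ is a map $f:V(G)\to\{1,\dots,t\}$, with color classes $V_i=\{v: f(v)=i\}$. It is equitable if $\big||V_i|-|V_j|\big|\le 1$ for all $i,j$. A $(t,k)$-tree-coloring of $G$ is a $t$-coloring such that every connected component of each induced subgraph $G[V_i]$ is a tree of maximum degree at most $k$; an equitable $(t,k)$-tree-coloring is a $(t,k)$-tree-coloring that is equitable. The strong equitable vertex $k$-arboricity $va_k^{\equiv}(G)$ is the smallest integer $t$ such that $G$ has an equitable $(t',k)$-tree-coloring for every integer $t'\ge t$. $K_{n,n,n}$ denotes the complete tripartite graph whose three partite sets each have exactly $n$ vertices. -}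

module Defs where

open import Data.Nat using (ℕ; zero; suc; _+_; _*_; _≤_)
open import Data.Bool using (Bool; true; false; not; _∧_)
open import Data.Fin using (Fin; zero; suc; inject₁; fromℕ; remQuot)
open import Data.Fin.Properties using (_≟_)
open import Data.List using (List; length; filter)
open import Data.List using () renaming (allFin to allFinL)
open import Data.Product using (Σ; _×_; proj₁)
open import Relation.Nullary using (does)
open import Relation.Unary using (Pred)
open import Relation.Binary.PropositionalEquality using (_≡_)
open import Function.Definitions using (Injective)
open import Data.Empty using (⊥)
open import Level using (0ℓ)

record Graph : Set where
  field
    N     : ℕ
    adj   : Fin N → Fin N → Bool
    sym   : ∀ u v → adj u v ≡ adj v u
    irrefl : ∀ v → adj v v ≡ false
open Graph public

Adj : (G : Graph) → Fin (N G) → Fin (N G) → Set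
Adj G u v = adj G u v ≡ true

_≡ᵇ_ : ∀ {t} → Fin t → Fin t → Bool
i ≡ᵇ j = does (i ≟ j)

classSize : (G : Graph) {t : ℕ} → (Fin (N G) → Fin t) → Fin t → ℕ
classSize G f i = length (filter (λ v → f v ≟ i) (allFinL (N G)))

classDegree : (G : Graph) {t : ℕ} → (Fin (N G) → Fin t) → Fin (N G) → ℕ
classDegree G f v =
  length (filter (λ w → Data.Bool._≟_ (adj G v w ∧ (f w ≡ᵇ f v)) true) (allFinL (N G)))

record MonoCycle (G : Graph) {t : ℕ} (f : Fin (N G) → Fin t) (i : Fin t) : Set where
  field
    m      : ℕ
    c      : Fin (suc (suc (suc m))) → Fin (N G)
    inj    : Injective _≡_ _≡_ c
    colour : ∀ j → f (c j) ≡ i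
    step   : ∀ (j : Fin (suc (suc m))) → Adj G (c (inject₁ j)) (c (suc j))
    close  : Adj G (c (fromℕ (suc (suc m)))) (c zero)

-- (t,k)-tree-colouring: every component of every G[V_i] is a tree
-- (i.e. G[V_i] has no cycle) of maximum degree at most k.
IsTreeColoring : (G : Graph) (t k : ℕ) → (Fin (N G) → Fin t) → Set
IsTreeColoring G t k f =
  (∀ i → MonoCycle G f i → ⊥) × (∀ v → classDegree G f v ≤ k)

IsEquitable : (G : Graph) (t : ℕ) → (Fin (N G) → Fin t) → Set
IsEquitable G t f = ∀ i j → classSize G f i ≤ suc (classSize G f j)

HasEqTreeColoring : (G : Graph) (t k : ℕ) → Set
HasEqTreeColoring G t k =
  Σ (Fin (N G) → Fin t) λ f → IsTreeColoring G t k f × IsEquitable G t f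

-- va_k^≡(G) ≤ b : since va_k^≡(G) is the least t such that G has an
-- equitable (t',k)-tree-colouring for every t' ≥ t, this holds iff
-- every t' ≥ b admits one.
StrongEqVA-≤ : (G : Graph) (k b : ℕ) → Set
StrongEqVA-≤ G k b = ∀ t′ → b ≤ t′ → HasEqTreeColoring G t′ k

part : (n : ℕ) → Fin (3 * n) → Fin 3
part n v = proj₁ (remQuot {3} n v)

private
  kadj : (n : ℕ) → Fin (3 * n) → Fin (3 * n) → Bool
  kadj n u v = not (part n u ≡ᵇ part n v)

  ≡ᵇ-sym : ∀ {t} (i j : Fin t) → (i ≡ᵇ j) ≡ (j ≡ᵇ i)
  ≡ᵇ-sym i j with i ≟ j | j ≟ i
  ... | Relation.Nullary.yes _ | Relation.Nullary.yes _ = Relation.Binary.PropositionalEquality.refl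
  ... | Relation.Nullary.no _  | Relation.Nullary.no _  = Relation.Binary.PropositionalEquality.refl
  ... | Relation.Nullary.yes p | Relation.Nullary.no q  = Data.Empty.⊥-elim (q (Relation.Binary.PropositionalEquality.sym p))
  ... | Relation.Nullary.no q  | Relation.Nullary.yes p = Data.Empty.⊥-elim (q (Relation.Binary.PropositionalEquality.sym p))

  ≡ᵇ-refl : ∀ {t} (i : Fin t) → (i ≡ᵇ i) ≡ true
  ≡ᵇ-refl i with i ≟ i
  ... | Relation.Nullary.yes _ = Relation.Binary.PropositionalEquality.refl
  ... | Relation.Nullary.no q = Data.Empty.⊥-elim (q Relation.Binary.PropositionalEquality.refl)

K₃ : ℕ → Graph
K₃ n = record
  { N = 3 * n
  ; adj = kadj n
  ; sym = λ u v → Relation.Binary.PropositionalEquality.cong not (≡ᵇ-sym (part n u) (part n v))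
  ; irrefl = λ v → Relation.Binary.PropositionalEquality.cong not (≡ᵇ-refl (part n v))
  }

-- Number the vertices of K₃ n as 0, …, 3n − 1, so that part p is the interval
-- [np, np + n), and colour by cutting this line into consecutive blocks whose
-- sizes differ by at most one. A block induces a forest of maximum degree ≤ 3
-- as soon as all of its vertices but possibly one (a centre) lie in one part,
-- and it either has at most four vertices or lies inside a part. For n = 4k
-- with k = 5m + 3 and t ≥ (12k + 4)/5 = 12m + 8 such cuttings exist: blocks
-- of size ≤ 3 when t > 4k; blocks of size 3 followed by blocks of size 4
-- aligned to multiples of 4 when 3k ≤ t ≤ 4k; each part cut separately into
-- blocks of size 4 and 5 when 12m + 9 ≤ t < 3k; and for t = 12m + 8, where no
-- part can be cut separately, two blocks of size 4 straddle part boundaries.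
module Submission where

open import Defs hiding (sym)
open import Data.Bool using (true; false; not; _∧_)
import Data.Bool as Bool
open import Data.Bool.Properties using (∧-conicalˡ; ∧-conicalʳ)
open import Data.Empty using (⊥)
open import Data.Fin using (Fin; zero; suc; toℕ; fromℕ; fromℕ<; combine; remQuot)
open import Data.Fin.Properties using (toℕ-injective; toℕ<n; toℕ-fromℕ<; toℕ-combine; combine-remQuot; _≟_)
import Data.List as List
open import Data.List using (List; []; _∷_; _++_; length; filter; tabulate; lookup; allFin; replicate)
open import Data.List.Membership.Propositional using (_∈_)
open import Data.List.Membership.Propositional.Properties using (∈-lookup; ∈-allFin)
open import Data.List.Properties using (filter-none; length-++; length-replicate)
open import Data.List.Relation.Unary.All as All using (All; []; _∷_)
open import Data.List.Relation.Unary.All.Properties using (tabulate⁺; ++⁺; replicate⁺)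
open import Data.List.Relation.Unary.Any using (here; there)
import Data.Nat as ℕ
open import Data.Nat using (ℕ; zero; suc; _+_; _*_; _∸_; _⊓_; _≤_; _<_; z≤n; s≤s; s≤s⁻¹; _<?_; _≤?_; NonZero)
open import Data.Nat.DivMod using (_/_; _%_; m≡m%n+[m/n]*n; m%n<n; m*n/n≡m)
open import Data.Nat.ListAction using (sum)
open import Data.Nat.ListAction.Properties using (sum-++)
open import Data.Nat.Properties hiding (_≟_)
open import Data.Nat.Tactic.RingSolver using (solve; solve-∀)
open import Data.Product using (Σ; _×_; _,_; proj₁; proj₂)
open import Data.Sum using (_⊎_; inj₁; inj₂)
open import Data.Unit using (⊤; tt)
open import Function using (id; _∘′_)
open import Function.Bundles using (_⇔_; mk⇔; Equivalence)
open import Function.Properties.Equivalence using () renaming (trans to ⇔-trans)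
open import Level using (0ℓ)
open import Relation.Binary.Definitions using (tri<; tri≈; tri>)
open import Relation.Binary.PropositionalEquality
  using (_≡_; _≢_; refl; sym; trans; cong; cong₂; subst; subst₂; module ≡-Reasoning)
open import Relation.Nullary using (¬_; yes; no; contradiction)
open import Relation.Nullary.Decidable using (dec-true)
open import Relation.Unary using (Pred; Decidable)

Within : ℕ → ℕ → ℕ → Set
Within lo s x = lo ≤ x × x < lo + s

Within-empty : ∀ {lo x} → ¬ Within lo 0 x
Within-empty {lo} {x} (lo≤x , x<lo+0) = <⇒≱ (subst (x <_) (+-identityʳ lo) x<lo+0) lo≤x

Within-suc : ∀ {lo s x} → Within (suc lo) s (suc x) ⇔ Within lo s x
Within-suc = mk⇔ (λ { (s≤s lo≤x , s≤s x<) → lo≤x , x< }) (λ { (lo≤x , x<) → s≤s lo≤x , s≤s x< })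

Within-zero-suc : ∀ {s x} → Within 0 (suc s) (suc x) ⇔ Within 0 s x
Within-zero-suc = mk⇔ (λ { (_ , s≤s x<) → z≤n , x< }) (λ { (_ , x<) → z≤n , s≤s x< })

Within-⊆ : ∀ {lo s lo′ s′ x} → lo′ ≤ lo → lo + s ≤ lo′ + s′ → Within lo s x → Within lo′ s′ x
Within-⊆ lo′≤lo end≤end′ (lo≤x , x<end) = ≤-trans lo′≤lo lo≤x , <-≤-trans x<end end≤end′

Within-drop-first : ∀ {lo s x} → Within lo (suc s) x → x ≢ lo → Within (suc lo) s x
Within-drop-first {lo} {s} {x} (lo≤x , x<end) x≢lo =
  ≤∧≢⇒< lo≤x (λ lo≡x → x≢lo (sym lo≡x)) , subst (x <_) (+-suc lo s) x<end

Within-drop-last : ∀ {lo s x} → Within lo (suc s) x → x ≢ lo + s → Within lo s x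
Within-drop-last {lo} {s} {x} (lo≤x , x<end) x≢last =
  lo≤x , ≤∧≢⇒< (s≤s⁻¹ (subst (x <_) (+-suc lo s) x<end)) x≢last

module _ {A : Set} {P : Pred A 0ℓ} (P? : Decidable P) where
  open Equivalence

  length-filter-Within : ∀ {M} (g : Fin M → A) lo s → lo + s ≤ M →
    (∀ v → P (g v) ⇔ Within lo s (toℕ v)) → length (filter P? (tabulate g)) ≡ s
  length-filter-Within g zero zero _ P⇔ =
    cong length (filter-none P? (tabulate⁺ λ v → Within-empty ∘′ to (P⇔ v)))
  length-filter-Within {suc M} g zero (suc s) (s≤s bound) P⇔ with P? (g zero)
  ... | yes _ = cong suc (length-filter-Within (λ v → g (suc v)) zero s bound
                           λ v → ⇔-trans (P⇔ (suc v)) Within-zero-suc)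
  ... | no ¬p = contradiction (from (P⇔ zero) (z≤n , s≤s z≤n)) ¬p
  length-filter-Within {suc M} g (suc lo) s (s≤s bound) P⇔ with P? (g zero)
  ... | yes p = contradiction (proj₁ (to (P⇔ zero) p)) λ ()
  ... | no _ = length-filter-Within (λ v → g (suc v)) lo s bound
                 λ v → ⇔-trans (P⇔ (suc v)) Within-suc

module _ {A : Set} {P Q : Pred A 0ℓ} (P? : Decidable P) (Q? : Decidable Q) (P⇒Q : ∀ {x} → P x → Q x) where
  length-filter-mono : ∀ xs → length (filter P? xs) ≤ length (filter Q? xs)
  length-filter-mono [] = z≤n
  length-filter-mono (x ∷ xs) with P? x | Q? x
  ... | yes _ | yes _ = s≤s (length-filter-mono xs)
  ... | yes p | no ¬q = contradiction (P⇒Q p) ¬q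
  ... | no _  | yes _ = m≤n⇒m≤1+n (length-filter-mono xs)
  ... | no _  | no _  = length-filter-mono xs

  length-filter-mono-< : ∀ {y} xs → y ∈ xs → Q y → ¬ P y → length (filter P? xs) < length (filter Q? xs)
  length-filter-mono-< (x ∷ xs) (here refl) qy ¬py with P? x | Q? x
  ... | yes py | _     = contradiction py ¬py
  ... | no _   | yes _ = s≤s (length-filter-mono xs)
  ... | no _   | no ¬q = contradiction qy ¬q
  length-filter-mono-< (x ∷ xs) (there y∈xs) qy ¬py with P? x | Q? x
  ... | yes _ | yes _ = s≤s (length-filter-mono-< xs y∈xs qy ¬py)
  ... | yes p | no ¬q = contradiction (P⇒Q p) ¬q
  ... | no _  | yes _ = m≤n⇒m≤1+n (length-filter-mono-< xs y∈xs qy ¬py)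
  ... | no _  | no _  = length-filter-mono-< xs y∈xs qy ¬py

blockStart : ℕ → (L : List ℕ) → Fin (length L) → ℕ
blockStart o (s ∷ L) zero = o
blockStart o (s ∷ L) (suc i) = blockStart (o + s) L i

InBlock : ℕ → (L : List ℕ) → Fin (length L) → ℕ → Set
InBlock o L i = Within (blockStart o L i) (lookup L i)

blockStart-≥ : ∀ o L i → o ≤ blockStart o L i
blockStart-≥ o (s ∷ L) zero = ≤-refl
blockStart-≥ o (s ∷ L) (suc i) = ≤-trans (m≤m+n o s) (blockStart-≥ (o + s) L i)

blockEnd-≤ : ∀ o L i → blockStart o L i + lookup L i ≤ o + sum L
blockEnd-≤ o (s ∷ L) zero = +-monoʳ-≤ o (m≤m+n s (sum L))
blockEnd-≤ o (s ∷ L) (suc i) = ≤-trans (blockEnd-≤ (o + s) L i) (≤-reflexive (+-assoc o s (sum L)))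

<-+-assoc : ∀ {x} o s t → x < o + (s + t) → x < o + s + t
<-+-assoc {x} o s t = subst (x <_) (sym (+-assoc o s t))

blockOf : ∀ o L x → o ≤ x → x < o + sum L → Fin (length L)
blockOf o [] x o≤x x<o+0 = contradiction (o≤x , x<o+0) Within-empty
blockOf o (s ∷ L) x o≤x x<end with x <? o + s
... | yes _ = zero
... | no x≮ = suc (blockOf (o + s) L x (≮⇒≥ x≮) (<-+-assoc o s (sum L) x<end))

blockOf-InBlock : ∀ o L x o≤x x<end → InBlock o L (blockOf o L x o≤x x<end) x
blockOf-InBlock o [] x o≤x x<o+0 = contradiction (o≤x , x<o+0) Within-empty
blockOf-InBlock o (s ∷ L) x o≤x x<end with x <? o + s
... | yes x< = o≤x , x<
... | no x≮ = blockOf-InBlock (o + s) L x (≮⇒≥ x≮) (<-+-assoc o s (sum L) x<end)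

blockOf-unique : ∀ o L x o≤x x<end i → InBlock o L i x → blockOf o L x o≤x x<end ≡ i
blockOf-unique o (s ∷ L) x o≤x x<end i x∈i with x <? o + s | i
... | yes _  | zero = refl
... | yes x< | suc i = contradiction (≤-trans (blockStart-≥ (o + s) L i) (proj₁ x∈i)) (<⇒≱ x<)
... | no x≮  | zero = contradiction (proj₂ x∈i) x≮
... | no x≮  | suc i = cong suc (blockOf-unique (o + s) L x (≮⇒≥ x≮) (<-+-assoc o s (sum L) x<end) i x∈i)

InPart : ℕ → ℕ → ℕ → Set
InPart n p = Within (n * p) n

partStart-suc : ∀ n p → n * p + n ≡ n * suc p
partStart-suc n p = trans (+-comm (n * p) n) (sym (*-suc n p))

InPart-disjoint : ∀ n {p q x} → p < q → InPart n p x → ¬ InPart n q x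
InPart-disjoint n {p} {q} p<q (_ , x<) (nq≤x , _) =
  <⇒≱ x< (≤-trans (subst (_≤ n * q) (sym (partStart-suc n p)) (*-monoʳ-≤ n p<q)) nq≤x)

InPart-unique : ∀ n {p q x} → InPart n p x → InPart n q x → p ≡ q
InPart-unique n {p} {q} x∈p x∈q with <-cmp p q
... | tri< p<q _ _ = contradiction x∈q (InPart-disjoint n p<q x∈p)
... | tri≈ _ p≡q _ = p≡q
... | tri> _ _ q<p = contradiction x∈p (InPart-disjoint n q<p x∈q)

part-InPart : ∀ n v → InPart n (toℕ (part n v)) (toℕ v)
part-InPart n v = subst (InPart n (toℕ q)) (cong toℕ (combine-remQuot {3} n v)) combine-InPart
  where
  q = proj₁ (remQuot {3} n v)
  r = proj₂ (remQuot {3} n v)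
  combine-InPart : InPart n (toℕ q) (toℕ (combine q r))
  combine-InPart rewrite toℕ-combine q r = m≤m+n (n * toℕ q) (toℕ r) , +-monoʳ-< (n * toℕ q) (toℕ<n r)

partOf : ∀ n x → x < 3 * n → Σ ℕ λ p → InPart n p x
partOf n x x< = toℕ (part n v) , subst (InPart n _) (toℕ-fromℕ< x<) (part-InPart n v)
  where v = fromℕ< x<

adj-InPart : ∀ n {p} u w → InPart n p (toℕ u) → InPart n p (toℕ w) → adj (K₃ n) u w ≡ false
adj-InPart n u w u∈p w∈p = cong not (dec-true (part n u ≟ part n w) same-part)
  where
  same-part : part n u ≡ part n w
  same-part = toℕ-injective (trans (InPart-unique n (part-InPart n u) u∈p)
                                   (InPart-unique n w∈p (part-InPart n w)))

¬Adj : ∀ G {u w} → adj G u w ≡ false → ¬ Adj G u w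
¬Adj G not-adj is-adj = contradiction (trans (sym is-adj) not-adj) λ ()

≡ᵇ-true⇒≡ : ∀ {t} {i j : Fin t} → (i ≡ᵇ j) ≡ true → i ≡ j
≡ᵇ-true⇒≡ {i = i} {j} eq with i ≟ j
... | yes i≡j = i≡j
... | no _ = contradiction eq λ ()

-- In K₃ n the block [lo, lo + s) spans a star with at most three leaves, or no edge.
record StarBlock (n lo s : ℕ) : Set where
  field
    home   : ℕ
    centre : ℕ
    leaf-home : ∀ {x} → Within lo s x → x ≢ centre → InPart n home x
    small-or-independent : s ≤ 4 ⊎ (∀ {x} → Within lo s x → InPart n home x)

StarBlocks : ℕ → ℕ → List ℕ → Set
StarBlocks n o [] = ⊤
StarBlocks n o (s ∷ L) = StarBlock n o s × StarBlocks n (o + s) L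

StarBlocks-lookup : ∀ {n} o L → StarBlocks n o L → ∀ i → StarBlock n (blockStart o L i) (lookup L i)
StarBlocks-lookup o (s ∷ L) (star , _) zero = star
StarBlocks-lookup o (s ∷ L) (_ , stars) (suc i) = StarBlocks-lookup (o + s) L stars i

Balanced : ℕ → List ℕ → Set
Balanced s = All (λ x → s ≤ x × x ≤ suc s)

record BalancedSplit (N s : ℕ) : Set where
  field
    sizes     : List ℕ
    sum-sizes : sum sizes ≡ N
    balanced  : Balanced s sizes
open BalancedSplit

module BlockColouring (n : ℕ) (L : List ℕ) (sum-L : sum L ≡ 3 * n) where
  open Equivalence
  open StarBlock

  vertex<sum : ∀ v → toℕ v < sum L
  vertex<sum v = subst (toℕ v <_) (sym sum-L) (toℕ<n v)

  colour : Fin (3 * n) → Fin (length L)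
  colour v = blockOf 0 L (toℕ v) z≤n (vertex<sum v)

  colour-≡⇔ : ∀ v i → colour v ≡ i ⇔ InBlock 0 L i (toℕ v)
  colour-≡⇔ v i = mk⇔ (λ v∈i → subst (λ j → InBlock 0 L j (toℕ v)) v∈i in-own-block)
                      (blockOf-unique 0 L (toℕ v) z≤n (vertex<sum v) i)
    where in-own-block = blockOf-InBlock 0 L (toℕ v) z≤n (vertex<sum v)

  classSize-colour : ∀ i → classSize (K₃ n) colour i ≡ lookup L i
  classSize-colour i = length-filter-Within (λ v → colour v ≟ i) id (blockStart 0 L i) (lookup L i)
    (subst (blockStart 0 L i + lookup L i ≤_) sum-L (blockEnd-≤ 0 L i)) (λ v → colour-≡⇔ v i)

  colour-equitable : ∀ {s} → Balanced s L → IsEquitable (K₃ n) (length L) colour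
  colour-equitable balanced i j rewrite classSize-colour i | classSize-colour j =
    ≤-trans (proj₂ (size-near i)) (s≤s (proj₁ (size-near j)))
    where size-near = λ i → All.lookup balanced (∈-lookup i)

  module _ (stars : StarBlocks n 0 L) where
    star : ∀ i → StarBlock n (blockStart 0 L i) (lookup L i)
    star = StarBlocks-lookup 0 L stars

    leaves-nonadjacent : ∀ i {u w} → colour u ≡ i → colour w ≡ i →
      toℕ u ≢ centre (star i) → toℕ w ≢ centre (star i) → ¬ Adj (K₃ n) u w
    leaves-nonadjacent i {u} {w} u∈i w∈i u-leaf w-leaf = ¬Adj (K₃ n) (adj-InPart n u w
      (leaf-home (star i) (to (colour-≡⇔ u i) u∈i) u-leaf) (leaf-home (star i) (to (colour-≡⇔ w i) w∈i) w-leaf))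

    -- Of the consecutive cycle vertices c₀, c₁, c₂ and the last one cₗ, at most
    -- one is the centre, so one of the edges c₀c₁, c₁c₂, cₗc₀ joins two leaves.
    colour-acyclic : ∀ i → ¬ MonoCycle (K₃ n) colour i
    colour-acyclic i C = no-cycle
      where
      open MonoCycle C renaming (colour to coloured-i)

      no-leaf-edge : ∀ j j′ → toℕ (c j) ≢ centre (star i) → toℕ (c j′) ≢ centre (star i) →
        ¬ Adj (K₃ n) (c j) (c j′)
      no-leaf-edge j j′ = leaves-nonadjacent i (coloured-i j) (coloured-i j′)

      centre-unique : ∀ {j j′} → toℕ (c j) ≡ centre (star i) → toℕ (c j′) ≡ centre (star i) → j ≡ j′
      centre-unique j-centre j′-centre = inj (toℕ-injective (trans j-centre (sym j′-centre)))

      no-cycle : ⊥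
      no-cycle with toℕ (c zero) ℕ.≟ centre (star i) | toℕ (c (suc zero)) ℕ.≟ centre (star i)
      ... | yes c₀-centre | _ = no-leaf-edge (suc zero) (suc (suc zero))
            (λ c₁-centre → contradiction (centre-unique c₁-centre c₀-centre) λ ())
            (λ c₂-centre → contradiction (centre-unique c₂-centre c₀-centre) λ ())
            (step (suc zero))
      ... | no c₀-leaf | no c₁-leaf = no-leaf-edge zero (suc zero) c₀-leaf c₁-leaf (step zero)
      ... | no c₀-leaf | yes c₁-centre = no-leaf-edge (fromℕ (suc (suc m))) zero
            (λ cₗ-centre → contradiction (centre-unique cₗ-centre c₁-centre) λ ())
            c₀-leaf close

    colour-degree : ∀ v → classDegree (K₃ n) colour v ≤ 3
    colour-degree v with small-or-independent (star (colour v))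
    ... | inj₁ size≤4 = ≤-pred (begin-strict
        classDegree (K₃ n) colour v
          <⟨ length-filter-mono-< P? Q? P⇒Q (allFin (3 * n)) (∈-allFin v) refl ¬Pv ⟩
        classSize (K₃ n) colour (colour v)   ≡⟨ classSize-colour (colour v) ⟩
        lookup L (colour v)                  ≤⟨ size≤4 ⟩
        4                                    ∎)
      where
      open ≤-Reasoning
      P? = λ w → adj (K₃ n) v w ∧ (colour w ≡ᵇ colour v) Bool.≟ true
      Q? = λ w → colour w ≟ colour v
      P⇒Q : ∀ {w} → (adj (K₃ n) v w ∧ (colour w ≡ᵇ colour v)) ≡ true → colour w ≡ colour v
      P⇒Q {w} e = ≡ᵇ-true⇒≡ (∧-conicalʳ (adj (K₃ n) v w) _ e)
      ¬Pv : (adj (K₃ n) v v ∧ (colour v ≡ᵇ colour v)) ≢ true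
      ¬Pv e = ¬Adj (K₃ n) (irrefl (K₃ n) v) (∧-conicalˡ _ _ e)
    ... | inj₂ independent = ≤-trans (≤-reflexive (cong length (filter-none _ (tabulate⁺ no-neighbour)))) z≤n
      where
      in-home : ∀ u → colour u ≡ colour v → InPart n (StarBlock.home (star (colour v))) (toℕ u)
      in-home u u∈ = independent (to (colour-≡⇔ u (colour v)) u∈)
      no-neighbour : ∀ w → (adj (K₃ n) v w ∧ (colour w ≡ᵇ colour v)) ≢ true
      no-neighbour w e = ¬Adj (K₃ n) (adj-InPart n v w (in-home v refl) (in-home w w∈)) (∧-conicalˡ _ _ e)
        where w∈ = ≡ᵇ-true⇒≡ (∧-conicalʳ (adj (K₃ n) v w) _ e)

blockColouring : ∀ {n s} (P : BalancedSplit (3 * n) s) → StarBlocks n 0 (sizes P) →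
  HasEqTreeColoring (K₃ n) (length (sizes P)) 3
blockColouring {n} P stars =
  colour , (colour-acyclic stars , colour-degree stars) , colour-equitable (balanced P)
  where open BlockColouring n (sizes P) (sum-sizes P)

StarBlocks-∷ : ∀ {n o o′ s L} → StarBlock n o s → o + s ≡ o′ → StarBlocks n o′ L → StarBlocks n o (s ∷ L)
StarBlocks-∷ star refl stars = star , stars

StarBlocks-++ : ∀ {n o o′} L₁ {L₂} → StarBlocks n o L₁ → o + sum L₁ ≡ o′ → StarBlocks n o′ L₂ →
  StarBlocks n o (L₁ ++ L₂)
StarBlocks-++ {o = o} [] _ refl stars₂ = subst (λ o → StarBlocks _ o _) (+-identityʳ o) stars₂
StarBlocks-++ {o = o} (s ∷ L₁) (star , stars₁) refl stars₂ =
  star , StarBlocks-++ L₁ stars₁ (+-assoc o s (sum L₁)) stars₂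

starBlocks : ∀ {n lo hi} {P : ℕ → Set} → (∀ {o s} → lo ≤ o → o + s ≤ hi → P s → StarBlock n o s) →
  ∀ o L → lo ≤ o → o + sum L ≤ hi → All P L → StarBlocks n o L
starBlocks star o [] _ _ [] = tt
starBlocks {hi = hi} star o (s ∷ L) lo≤o end≤ (ps ∷ pL) =
  star lo≤o (≤-trans (+-monoʳ-≤ o (m≤m+n s (sum L))) end≤) ps ,
  starBlocks star (o + s) L (≤-trans lo≤o (m≤m+n o s)) (subst (_≤ hi) (sym (+-assoc o s (sum L))) end≤) pL

emptyBlock : ∀ {n lo} → StarBlock n lo 0
emptyBlock = record
  { home = 0 ; centre = 0
  ; leaf-home = λ x∈ _ → contradiction x∈ Within-empty
  ; small-or-independent = inj₁ z≤n }

insideBlock : ∀ {n p lo s} → n * p ≤ lo → lo + s ≤ n * p + n → StarBlock n lo s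
insideBlock {p = p} start≤lo end≤ = record
  { home = p ; centre = 0
  ; leaf-home = λ x∈ _ → Within-⊆ start≤lo end≤ x∈
  ; small-or-independent = inj₂ (Within-⊆ start≤lo end≤) }

insideBlocks : ∀ {n} p o L → n * p ≤ o → o + sum L ≤ n * p + n → StarBlocks n o L
insideBlocks p o L start≤o end≤ =
  starBlocks (λ start≤ end≤′ _ → insideBlock start≤ end≤′) o L start≤o end≤ (All.universal (λ _ → tt) L)

centreFirstBlock : ∀ {n p lo s} → s ≤ 3 → n * p ≤ suc lo → suc lo + s ≤ n * p + n → StarBlock n lo (suc s)
centreFirstBlock {p = p} {lo} s≤3 start≤ end≤ = record
  { home = p ; centre = lo
  ; leaf-home = λ x∈ x≢lo → Within-⊆ start≤ end≤ (Within-drop-first x∈ x≢lo)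
  ; small-or-independent = inj₁ (s≤s s≤3) }

centreLastBlock : ∀ {n p lo s} → s ≤ 3 → n * p ≤ lo → lo + s ≤ n * p + n → StarBlock n lo (suc s)
centreLastBlock {p = p} {lo} {s} s≤3 start≤ end≤ = record
  { home = p ; centre = lo + s
  ; leaf-home = λ x∈ x≢last → Within-⊆ start≤ end≤ (Within-drop-last x∈ x≢last)
  ; small-or-independent = inj₁ (s≤s s≤3) }

-- A block of at most three vertices meets at most two parts since n ≥ 3, and if it
-- meets two then one of them only in its first or in its last vertex.
smallBlock : ∀ {n lo s} → 3 ≤ n → s ≤ 3 → lo + s ≤ 3 * n → StarBlock n lo s
smallBlock {s = zero} _ _ _ = emptyBlock
smallBlock {n} {lo} {suc s} 3≤n (s≤s s≤2) end≤ with partOf n lo (<-≤-trans (m<m+n lo (s≤s z≤n)) end≤)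
... | p , (start≤lo , lo<end) with lo + suc s ≤? n * p + n
...   | yes inside = insideBlock start≤lo inside
...   | no _ with n * p + n ≤? suc lo
...     | yes boundary≤ = centreFirstBlock s≤3
          (subst (_≤ suc lo) (partStart-suc n p) boundary≤)
          (subst (suc lo + s ≤_) (cong (_+ n) (partStart-suc n p)) (+-mono-≤ lo<end (≤-trans s≤3 3≤n)))
  where s≤3 = m≤n⇒m≤1+n s≤2
...     | no boundary> = centreLastBlock (m≤n⇒m≤1+n s≤2) start≤lo
          (≤-trans (subst (_≤ 2 + lo) (+-comm s lo) (+-monoˡ-≤ lo s≤2)) (≰⇒> boundary>))

smallBlocks : ∀ {n} o L → 3 ≤ n → All (_≤ 3) L → o + sum L ≤ 3 * n → StarBlocks n o L
smallBlocks o L 3≤n L≤3 end≤ =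
  starBlocks (λ _ end≤′ s≤3 → smallBlock 3≤n s≤3 end≤′) o L z≤n end≤ L≤3

alignedBlocks : ∀ d k a c → a + c ≤ 3 * k → StarBlocks (d * k) (d * a) (replicate c d)
alignedBlocks d k a zero _ = tt
alignedBlocks d k a (suc c) end≤ with partOf k a (<-≤-trans (m<m+n a (s≤s z≤n)) end≤)
... | p , (start≤a , a<end) =
  StarBlocks-∷ (insideBlock start≤ block-end≤) d*a+d≡d*[1+a]
    (alignedBlocks d k (suc a) c (subst (_≤ 3 * k) (+-suc a c) end≤))
  where
  open ≤-Reasoning
  d*a+d≡d*[1+a] : d * a + d ≡ d * suc a
  d*a+d≡d*[1+a] = partStart-suc d a
  start≤ : d * k * p ≤ d * a
  start≤ = subst (_≤ d * a) (sym (*-assoc d k p)) (*-monoʳ-≤ d start≤a)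
  block-end≤ : d * a + d ≤ d * k * p + d * k
  block-end≤ = begin
    d * a + d           ≡⟨ d*a+d≡d*[1+a] ⟩
    d * suc a           ≤⟨ *-monoʳ-≤ d a<end ⟩
    d * (k * p + k)     ≡⟨ *-distribˡ-+ d (k * p) k ⟩
    d * (k * p) + d * k ≡⟨ cong (_+ d * k) (*-assoc d k p) ⟨
    d * k * p + d * k   ∎

twoSizes : ℕ → ℕ → ℕ → ℕ → List ℕ
twoSizes a x b y = replicate a x ++ replicate b y

length-twoSizes : ∀ a x b y → length (twoSizes a x b y) ≡ a + b
length-twoSizes a x b y = trans (length-++ (replicate a x)) (cong₂ _+_ (length-replicate a) (length-replicate b))

sum-replicate : ∀ c x → sum (replicate c x) ≡ c * x
sum-replicate zero x = refl
sum-replicate (suc c) x = cong (x +_) (sum-replicate c x)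

sum-twoSizes : ∀ a x b y → sum (twoSizes a x b y) ≡ a * x + b * y
sum-twoSizes a x b y = trans (sum-++ (replicate a x) (replicate b y)) (cong₂ _+_ (sum-replicate a x) (sum-replicate b y))

≤-by : ∀ {x y} d → x + d ≡ y → x ≤ y
≤-by {x} d x+d≡y = subst (x ≤_) x+d≡y (m≤m+n x d)

equipartition : ∀ N t .{{_ : NonZero t}} → Σ (BalancedSplit N (N / t)) λ P → length (sizes P) ≡ t
equipartition N t with m≤n⇒∃[o]m+o≡n (<⇒≤ (m%n<n N t))
... | d , r+d≡t = P , trans (length-twoSizes r (suc q) d q) r+d≡t
  where
  open ≡-Reasoning
  q = N / t
  r = N % t
  rearrange : ∀ r q d → r * suc q + d * q ≡ r + q * (r + d)
  rearrange = solve-∀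
  P : BalancedSplit N q
  sizes P = twoSizes r (suc q) d q
  sum-sizes P = begin
    sum (twoSizes r (suc q) d q) ≡⟨ sum-twoSizes r (suc q) d q ⟩
    r * suc q + d * q            ≡⟨ rearrange r q d ⟩
    r + q * (r + d)              ≡⟨ cong (λ t → r + q * t) r+d≡t ⟩
    r + q * t                    ≡⟨ m≡m%n+[m/n]*n N t ⟨
    N                            ∎
  balanced P = ++⁺ (replicate⁺ r (n≤1+n q , ≤-refl)) (replicate⁺ d (≤-refl , n≤1+n q))

colouring-n<t : ∀ n t → 3 ≤ n → n < t → HasEqTreeColoring (K₃ n) t 3
colouring-n<t n t@(suc _) 3≤n n<t with equipartition (3 * n) t
... | P , length≡ =
  subst (λ t → HasEqTreeColoring (K₃ n) t 3) length≡
    (blockColouring P (smallBlocks 0 (sizes P) 3≤n sizes≤3 (≤-reflexive (sum-sizes P))))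
  where
  q = 3 * n / t
  q<3 : q < 3
  q<3 = *-cancelʳ-< t q 3 (begin-strict
    q * t             ≤⟨ m≤n+m (q * t) (3 * n % t) ⟩
    3 * n % t + q * t ≡⟨ m≡m%n+[m/n]*n (3 * n) t ⟨
    3 * n             <⟨ *-monoʳ-< 3 n<t ⟩
    3 * t             ∎)
    where open ≤-Reasoning
  sizes≤3 : All (_≤ 3) (sizes P)
  sizes≤3 = All.map (λ (_ , x≤1+q) → ≤-trans x≤1+q q<3) (balanced P)

threesFours-colouring : ∀ a b → 0 < a + b → HasEqTreeColoring (K₃ (4 * (a + b))) (3 * (a + b) + a) 3
threesFours-colouring a b a+b>0 =
  subst (λ t → HasEqTreeColoring (K₃ n) t 3) length≡ (blockColouring P stars)
  where
  n = 4 * (a + b)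
  threes = replicate (4 * a) 3
  sum-threes : sum threes ≡ 4 * (3 * a)
  sum-threes = trans (sum-replicate (4 * a) 3) (trans (*-assoc 4 a 3) (cong (4 *_) (*-comm a 3)))
  3n≡ : 3 * (4 * (a + b)) ≡ 4 * (3 * a) + 4 * (3 * b)
  3n≡ = solve (a List.∷ b List.∷ List.[])
  count-blocks : 4 * a + 3 * b ≡ 3 * (a + b) + a
  count-blocks = solve (a List.∷ b List.∷ List.[])
  length≡ : length (twoSizes (4 * a) 3 (3 * b) 4) ≡ 3 * (a + b) + a
  length≡ = trans (length-twoSizes (4 * a) 3 (3 * b) 4) count-blocks
  P : BalancedSplit (3 * n) 3
  sizes P = twoSizes (4 * a) 3 (3 * b) 4
  sum-sizes P = trans (sum-++ threes (replicate (3 * b) 4))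
    (trans (cong₂ _+_ sum-threes (trans (sum-replicate (3 * b) 4) (*-comm (3 * b) 4))) (sym 3n≡))
  balanced P = ++⁺ (replicate⁺ (4 * a) (≤-refl , n≤1+n 3)) (replicate⁺ (3 * b) (n≤1+n 3 , ≤-refl))
  stars : StarBlocks n 0 (sizes P)
  stars = StarBlocks-++ threes
    (smallBlocks 0 threes (≤-trans (n≤1+n 3) (*-monoʳ-≤ 4 a+b>0)) (replicate⁺ (4 * a) ≤-refl)
       (subst (_≤ 3 * n) (sym sum-threes) (subst (4 * (3 * a) ≤_) (sym 3n≡) (m≤m+n _ _))))
    sum-threes
    (alignedBlocks 4 (a + b) (3 * a) (3 * b) (≤-reflexive (sym (*-distribˡ-+ 3 a b))))

partwise-colouring : ∀ {n s} (P₀ P₁ P₂ : BalancedSplit n s) →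
  HasEqTreeColoring (K₃ n) (length (sizes P₀) + length (sizes P₁) + length (sizes P₂)) 3
partwise-colouring {n} {s} P₀ P₁ P₂ =
  subst (λ t → HasEqTreeColoring (K₃ n) t 3) length≡ (blockColouring P stars)
  where
  L₀ = sizes P₀
  L₁ = sizes P₁
  L₂ = sizes P₂
  P : BalancedSplit (3 * n) s
  sizes P = L₀ ++ L₁ ++ L₂
  sum-sizes P = begin
    sum (L₀ ++ L₁ ++ L₂)       ≡⟨ sum-++ L₀ (L₁ ++ L₂) ⟩
    sum L₀ + sum (L₁ ++ L₂)    ≡⟨ cong (sum L₀ +_) (sum-++ L₁ L₂) ⟩
    sum L₀ + (sum L₁ + sum L₂) ≡⟨ cong₂ _+_ (sum-sizes P₀) (cong₂ _+_ (sum-sizes P₁) (sum-sizes P₂)) ⟩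
    n + (n + n)                ≡⟨ cong (λ m → n + (n + m)) (+-identityʳ n) ⟨
    3 * n                      ∎
    where open ≡-Reasoning
  balanced P = ++⁺ (balanced P₀) (++⁺ (balanced P₁) (balanced P₂))
  length≡ : length (L₀ ++ L₁ ++ L₂) ≡ length L₀ + length L₁ + length L₂
  length≡ = trans (length-++ L₀) (trans (cong (length L₀ +_) (length-++ L₁)) (sym (+-assoc (length L₀) _ _)))
  inPart : ∀ p (Q : BalancedSplit n s) → StarBlocks n (n * p) (sizes Q)
  inPart p Q = insideBlocks p (n * p) (sizes Q) ≤-refl (≤-reflexive (cong (n * p +_) (sum-sizes Q)))
  nextPart : ∀ p (Q : BalancedSplit n s) → n * p + sum (sizes Q) ≡ n * suc p
  nextPart p Q = trans (cong (n * p +_) (sum-sizes Q)) (partStart-suc n p)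
  stars : StarBlocks n 0 (sizes P)
  stars = subst (λ o → StarBlocks n o (sizes P)) (*-zeroʳ n)
    (StarBlocks-++ L₀ (inPart 0 P₀) (nextPart 0 P₀) (StarBlocks-++ L₁ (inPart 1 P₁) (nextPart 1 P₁) (inPart 2 P₂)))

fourFiveSplit : ∀ m β → β ≤ m → Σ (BalancedSplit (4 * (5 * m + 3)) 4) λ P → length (sizes P) ≡ 3 + 4 * m + β
fourFiveSplit m β β≤m with m≤n⇒∃[o]m+o≡n β≤m
... | α , refl = P , trans (length-twoSizes (3 + 5 * β) 4 (4 * α) 5) (count-blocks β α)
  where
  count-vertices : ∀ β α → (3 + 5 * β) * 4 + 4 * α * 5 ≡ 4 * (5 * (β + α) + 3)
  count-vertices = solve-∀
  count-blocks : ∀ β α → 3 + 5 * β + 4 * α ≡ 3 + 4 * (β + α) + β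
  count-blocks = solve-∀
  P : BalancedSplit (4 * (5 * (β + α) + 3)) 4
  sizes P = twoSizes (3 + 5 * β) 4 (4 * α) 5
  sum-sizes P = trans (sum-twoSizes (3 + 5 * β) 4 (4 * α) 5) (count-vertices β α)
  balanced P = ++⁺ (replicate⁺ (3 + 5 * β) (≤-refl , n≤1+n 4)) (replicate⁺ (4 * α) (n≤1+n 4 , ≤-refl))

split-≤+ : ∀ m m′ w → w ≤ m + m′ → Σ ℕ λ a → Σ ℕ λ b → a ≤ m × b ≤ m′ × a + b ≡ w
split-≤+ m m′ w w≤ = m ⊓ w , w ∸ m , m⊓n≤m m w , m≤n+o⇒m∸n≤o w m w≤ , m⊓n+n∸m≡n m w

foursFives-colouring : ∀ m w → w ≤ 3 * m → HasEqTreeColoring (K₃ (4 * (5 * m + 3))) (12 * m + 9 + w) 3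
foursFives-colouring m w w≤3m with split-≤+ m (2 * m) w w≤3m
... | β₀ , rest , β₀≤m , rest≤2m , refl
  with split-≤+ m m rest (subst (rest ≤_) (cong (m +_) (+-identityʳ m)) rest≤2m)
... | β₁ , β₂ , β₁≤m , β₂≤m , refl
  with fourFiveSplit m β₀ β₀≤m | fourFiveSplit m β₁ β₁≤m | fourFiveSplit m β₂ β₂≤m
... | P₀ , len₀ | P₁ , len₁ | P₂ , len₂ =
  subst (λ t → HasEqTreeColoring (K₃ (4 * (5 * m + 3))) t 3)
    (trans (cong₂ _+_ (cong₂ _+_ len₀ len₁) len₂) (count-blocks m β₀ β₁ β₂))
    (partwise-colouring P₀ P₁ P₂)
  where
  count-blocks : ∀ m β₀ β₁ β₂ →
    3 + 4 * m + β₀ + (3 + 4 * m + β₁) + (3 + 4 * m + β₂) ≡ 12 * m + 9 + (β₀ + (β₁ + β₂))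
  count-blocks = solve-∀

-- With n = 5a + 7 the blocks are: a fives and a four inside part 0; a four made of
-- the last three vertices of part 0 and, as centre, the first one of part 1; a + 1
-- fives inside part 1; a four made of the last vertex of part 1 as centre and the
-- first three of part 2; a fives and a four filling part 2.
straddling-colouring : ∀ a → HasEqTreeColoring (K₃ (5 * a + 7)) (3 * a + 5) 3
straddling-colouring a =
  subst (λ t → HasEqTreeColoring (K₃ (5 * a + 7)) t 3) length≡ (blockColouring P stars)
  where
  seg = replicate a 5 ++ 4 ∷ []
  mid = replicate (suc a) 5
  L = seg ++ 4 ∷ mid ++ 4 ∷ seg
  sum-seg : sum seg ≡ 5 * a + 4
  sum-seg = trans (sum-++ (replicate a 5) (4 ∷ [])) (cong (_+ 4) (trans (sum-replicate a 5) (*-comm a 5)))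
  sum-mid : sum mid ≡ 5 * a + 5
  sum-mid = trans (sum-replicate (suc a) 5) (solve (a List.∷ List.[]))
  P : BalancedSplit (3 * (5 * a + 7)) 4
  sizes P = L
  sum-sizes P = begin
    sum (seg ++ 4 ∷ mid ++ 4 ∷ seg)                   ≡⟨ sum-++ seg _ ⟩
    sum seg + (4 + sum (mid ++ 4 ∷ seg))              ≡⟨ cong (λ x → sum seg + (4 + x)) (sum-++ mid _) ⟩
    sum seg + (4 + (sum mid + (4 + sum seg)))         ≡⟨ cong₂ (λ x y → x + (4 + (y + (4 + x)))) sum-seg sum-mid ⟩
    5 * a + 4 + (4 + (5 * a + 5 + (4 + (5 * a + 4)))) ≡⟨ solve (a List.∷ List.[]) ⟩
    3 * (5 * a + 7)                                   ∎
    where open ≡-Reasoning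
  balanced P = ++⁺ seg-balanced (four ∷ ++⁺ (replicate⁺ (suc a) five) (four ∷ seg-balanced))
    where
    four : 4 ≤ 4 × 4 ≤ 5
    four = ≤-refl , n≤1+n 4
    five : 4 ≤ 5 × 5 ≤ 5
    five = n≤1+n 4 , ≤-refl
    seg-balanced : Balanced 4 seg
    seg-balanced = ++⁺ (replicate⁺ a five) (four ∷ [])
  length≡ : length L ≡ 3 * a + 5
  length≡ = begin
    length (seg ++ 4 ∷ mid ++ 4 ∷ seg)               ≡⟨ length-++ seg ⟩
    length seg + suc (length (mid ++ 4 ∷ seg))       ≡⟨ cong (λ x → length seg + suc x) (length-++ mid) ⟩
    length seg + suc (length mid + suc (length seg))
      ≡⟨ cong₂ (λ x y → x + suc (y + suc x)) length-seg (length-replicate (suc a)) ⟩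
    a + 1 + suc (suc a + suc (a + 1))                ≡⟨ solve (a List.∷ List.[]) ⟩
    3 * a + 5                                        ∎
    where
    open ≡-Reasoning
    length-seg : length seg ≡ a + 1
    length-seg = trans (length-++ (replicate a 5)) (cong (_+ 1) (length-replicate a))
  stars : StarBlocks (5 * a + 7) 0 L
  stars =
    StarBlocks-++ seg part₀ sum-seg (StarBlocks-∷ {o′ = 5 * a + 8} star₀ (solve (a List.∷ List.[]))
    (StarBlocks-++ {o′ = 10 * a + 13} mid part₁ (trans (cong (5 * a + 8 +_) sum-mid) (solve (a List.∷ List.[])))
    (StarBlocks-∷ {o′ = 10 * a + 17} star₁ (solve (a List.∷ List.[])) part₂)))
    where
    part₀ : StarBlocks (5 * a + 7) 0 seg
    part₀ = insideBlocks 0 0 seg (≤-reflexive (*-zeroʳ (5 * a + 7)))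
      (subst (_≤ (5 * a + 7) * 0 + (5 * a + 7)) (sym sum-seg) (≤-by 3 (solve (a List.∷ List.[]))))
    star₀ : StarBlock (5 * a + 7) (5 * a + 4) 4
    star₀ = centreLastBlock {5 * a + 7} {0} ≤-refl (≤-by (5 * a + 4) (solve (a List.∷ List.[])))
      (≤-reflexive (solve (a List.∷ List.[])))
    part₁ : StarBlocks (5 * a + 7) (5 * a + 8) mid
    part₁ = insideBlocks {5 * a + 7} 1 (5 * a + 8) mid (≤-by 1 (solve (a List.∷ List.[])))
      (subst (λ x → 5 * a + 8 + x ≤ (5 * a + 7) * 1 + (5 * a + 7)) (sym sum-mid) (≤-by 1 (solve (a List.∷ List.[]))))
    star₁ : StarBlock (5 * a + 7) (10 * a + 13) 4
    star₁ = centreFirstBlock {5 * a + 7} {2} ≤-refl (≤-reflexive (solve (a List.∷ List.[])))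
      (≤-by (5 * a + 4) (solve (a List.∷ List.[])))
    part₂ : StarBlocks (5 * a + 7) (10 * a + 17) seg
    part₂ = insideBlocks {5 * a + 7} 2 (10 * a + 17) seg (≤-by 3 (solve (a List.∷ List.[])))
      (subst (λ x → 10 * a + 17 + x ≤ (5 * a + 7) * 2 + (5 * a + 7)) (sym sum-seg)
        (≤-reflexive (solve (a List.∷ List.[]))))

colouring-3k≤t≤4k : ∀ k t → 0 < k → 3 * k ≤ t → t ≤ 4 * k → HasEqTreeColoring (K₃ (4 * k)) t 3
colouring-3k≤t≤4k k t k>0 3k≤t t≤4k with m≤n⇒∃[o]m+o≡n 3k≤t
... | a , refl with m≤n⇒∃[o]m+o≡n (+-cancelˡ-≤ (3 * k) a k (subst (3 * k + a ≤_) (+-comm k (3 * k)) t≤4k))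
... | b , refl = threesFours-colouring a b k>0

colouring-12m+9≤t≤15m+9 : ∀ m t → 12 * m + 9 ≤ t → t ≤ 15 * m + 9 →
  HasEqTreeColoring (K₃ (4 * (5 * m + 3))) t 3
colouring-12m+9≤t≤15m+9 m t lower≤t t≤upper with m≤n⇒∃[o]m+o≡n lower≤t
... | w , refl = foursFives-colouring m w (+-cancelˡ-≤ (12 * m + 9) w (3 * m) (subst (12 * m + 9 + w ≤_) upper≡ t≤upper))
  where
  upper≡ : 15 * m + 9 ≡ 12 * m + 9 + 3 * m
  upper≡ = solve (m List.∷ List.[])

colouring-12m+8≤t : ∀ m t → 12 * m + 8 ≤ t → HasEqTreeColoring (K₃ (4 * (5 * m + 3))) t 3
colouring-12m+8≤t m t lower≤t with 4 * (5 * m + 3) <? t | 3 * (5 * m + 3) ≤? t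
... | yes n<t | _ = colouring-n<t (4 * (5 * m + 3)) t (≤-by (20 * m + 9) (solve (m List.∷ List.[]))) n<t
... | no n≮t | yes 3k≤t =
  colouring-3k≤t≤4k (5 * m + 3) t (≤-by (5 * m + 2) (solve (m List.∷ List.[]))) 3k≤t (≮⇒≥ n≮t)
... | no _ | no 3k≰t with t ℕ.≟ 12 * m + 8
...   | yes refl = subst₂ (λ n t → HasEqTreeColoring (K₃ n) t 3) n≡ t≡ (straddling-colouring (4 * m + 1))
  where
  n≡ : 5 * (4 * m + 1) + 7 ≡ 4 * (5 * m + 3)
  n≡ = solve (m List.∷ List.[])
  t≡ : 3 * (4 * m + 1) + 5 ≡ 12 * m + 8
  t≡ = solve (m List.∷ List.[])
...   | no t≢ = colouring-12m+9≤t≤15m+9 m t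
          (subst (_≤ t) (sym (+-suc (12 * m) 8)) (≤∧≢⇒< lower≤t (λ e → t≢ (sym e))))
          (<⇒≤ (subst (t <_) 3k≡ (≰⇒> 3k≰t)))
  where
  3k≡ : 3 * (5 * m + 3) ≡ 15 * m + 9
  3k≡ = solve (m List.∷ List.[])

%≡⇒≡*/+ : ∀ k n r .{{_ : NonZero n}} → k % n ≡ r → k ≡ n * (k / n) + r
%≡⇒≡*/+ k n r k%n≡r = begin
  k                 ≡⟨ m≡m%n+[m/n]*n k n ⟩
  k % n + k / n * n ≡⟨ cong (_+ k / n * n) k%n≡r ⟩
  r + k / n * n     ≡⟨ +-comm r _ ⟩
  k / n * n + r     ≡⟨ cong (_+ r) (*-comm (k / n) n) ⟩
  n * (k / n) + r   ∎
  where open ≡-Reasoning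

-- The hypothesis 0 < k is implied by k % 5 ≡ 3.
lemma3 : (k : ℕ) → 0 < k → k % 5 ≡ 3 →
    StrongEqVA-≤ (K₃ (4 * k)) 3 ((12 * k + 4) / 5)
lemma3 k _ k%5≡3 t lower≤t with k / 5 | %≡⇒≡*/+ k 5 3 k%5≡3
... | m | refl = colouring-12m+8≤t m t (subst (_≤ t) lower≡ lower≤t)
  where
  lower≡ : (12 * (5 * m + 3) + 4) / 5 ≡ 12 * m + 8
  lower≡ = begin
    (12 * (5 * m + 3) + 4) / 5 ≡⟨ cong (_/ 5) {12 * (5 * m + 3) + 4} {(12 * m + 8) * 5} (solve (m List.∷ List.[])) ⟩
    (12 * m + 8) * 5 / 5       ≡⟨ m*n/n≡m (12 * m + 8) 5 ⟩
    12 * m + 8                 ∎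
    where open ≡-Reasoning
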